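{- Let $G_\sigma$ be a signed graph with at least three vertices that is sign connected and whose underlying graph is a block. Then $G_\sigma$ is a sign block if and only if $G_\sigma$ has no balancing vertex.
   Context: A signed graph $G_\sigma=(V,E;\sigma)$ consists of a finite undirected graph $G=(V,E)$, in which loops and multiple edges are allowed, together with a map $\sigma:E\to\{ -1,+1\}$. Cycles are elementary; a loop is a cycle of length 1. Chains are walks. The sign of a cycle or chain is the product of the signs of its edges, counted with multiplicity. $G_\sigma$ is balanced if every cycle is positive. Two vertices $x,y$ are sign connected if $x=y$ or there exist both a positive and a negative chain joining them. $G_\sigma$ is sign connected if every two vertices are sign connected. An articulation vertex of a graph is a vertex $v$ for which there exist edges $e,f$ such that every chain from $e$ to $f$ passes through $v$. A vertex supporting a loop is an articulation vertex unless it is incident with no other edge. A block is a maximal subgraph with no articulation vertex; the graph "is a block" if it has no articulation vertex. A sign articulation vertex of a sign-connected signed graph $G_\sigma$ is a vertex $x$ such that $G_\sigma-x$ (delete $x$ and its incident edges) is not sign connected. A sign-connected $G_\sigma$ is a sign block if it has no sign articulation vertex. A balancing vertex is a vertex $x$ such that $G_\sigma-x$ is balanced. -}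

module Defs where

open import Data.Nat using (ℕ; zero; suc)
open import Data.Fin using (Fin)
open import Data.Product using (_×_; _,_; Σ; ∃; ∃-syntax)
open import Data.Sum using (_⊎_)
open import Data.Sign using (Sign) renaming (_*_ to _⊛_)
open import Data.List using (List; []; _∷_)
open import Data.Maybe using (Maybe; just; nothing)
open import Data.List.Relation.Unary.All using (All)
open import Data.List.Relation.Unary.Unique.Propositional using (Unique)
open import Data.List.Membership.Propositional using (_∈_)
open import Relation.Binary.PropositionalEquality using (_≡_; _≢_)
open import Relation.Nullary using (¬_)

-- Each edge has an (unordered) pair of endpoints, stored as an ordered pair;
-- loops (equal endpoints) and multiple edges (distinct edges with the same
-- endpoints) are allowed.
record SignedGraph (n m : ℕ) : Set where
  field
    ends : Fin m → Fin n × Fin n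
    sgn  : Fin m → Sign
open SignedGraph public

module _ {n m : ℕ} (G : SignedGraph n m) where

  Joins : Fin m → Fin n → Fin n → Set
  Joins e u w = (ends G e ≡ (u , w)) ⊎ (ends G e ≡ (w , u))

  data Chain : Fin n → Fin n → Set where
    []   : (v : Fin n) → Chain v v
    step : {u w z : Fin n} (e : Fin m) → Joins e u w → Chain w z → Chain u z

  chainSign : {u v : Fin n} → Chain u v → Sign
  chainSign ([] v)        = Sign.+
  chainSign (step e _ c)  = sgn G e ⊛ chainSign c

  verts : {u v : Fin n} → Chain u v → List (Fin n)
  verts ([] v)                  = v ∷ []
  verts (step {u = u} e _ c)    = u ∷ verts c

  initVerts : {u v : Fin n} → Chain u v → List (Fin n)
  initVerts ([] v)               = []
  initVerts (step {u = u} e _ c) = u ∷ initVerts c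

  interior : {u v : Fin n} → Chain u v → List (Fin n)
  interior ([] v)        = []
  interior (step e _ c)  = initVerts c

  edgesOf : {u v : Fin n} → Chain u v → List (Fin m)
  edgesOf ([] v)        = []
  edgesOf (step e _ c)  = e ∷ edgesOf c

  firstEdge : {u v : Fin n} → Chain u v → Maybe (Fin m)
  firstEdge ([] v)        = nothing
  firstEdge (step e _ c)  = just e

  lastEdge : {u v : Fin n} → Chain u v → Maybe (Fin m)
  lastEdge ([] v)                 = nothing
  lastEdge (step e _ ([] _))      = just e
  lastEdge (step e _ c@(step _ _ _)) = lastEdge c

  -- an (elementary) cycle: a closed chain of length ≥ 1 whose edges are
  -- pairwise distinct and whose vertices v0, ..., v(k-1) are pairwise distinct
  -- (a loop is a cycle of length 1)
  record Cycle : Set where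
    field
      base     : Fin n
      walk     : Chain base base
      nonEmpty : ¬ (walk ≡ [] base)
      edgesDistinct : Unique (edgesOf walk)
      vertsDistinct : Unique (initVerts walk)
  open Cycle public

  Balanced : Set
  Balanced = (C : Cycle) → chainSign (walk C) ≡ Sign.+

  SignConnectedPair : Fin n → Fin n → Set
  SignConnectedPair x y =
    x ≡ y ⊎ ((Σ (Chain x y) λ c → chainSign c ≡ Sign.+)
           × (Σ (Chain x y) λ c → chainSign c ≡ Sign.-))

  SignConnected : Set
  SignConnected = (x y : Fin n) → SignConnectedPair x y

  ArticulationVertex : Fin n → Set
  ArticulationVertex v =
    ∃[ e ] ∃[ f ] ((u w : Fin n) (c : Chain u w) →
      firstEdge c ≡ just e → lastEdge c ≡ just f → v ∈ interior c)

  IsBlock : Set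
  IsBlock = (v : Fin n) → ¬ ArticulationVertex v

  -- Notions for the vertex-deleted signed graph G - x: chains / cycles of
  -- G - x are exactly the chains / cycles of G none of whose vertices is x.
  AvoidsVertex : Fin n → List (Fin n) → Set
  AvoidsVertex x vs = All (λ y → y ≢ x) vs

  SignConnectedPairDel : Fin n → Fin n → Fin n → Set
  SignConnectedPairDel x y z =
    y ≡ z ⊎ ((Σ (Chain y z) λ c → AvoidsVertex x (verts c) × chainSign c ≡ Sign.+)
           × (Σ (Chain y z) λ c → AvoidsVertex x (verts c) × chainSign c ≡ Sign.-))

  SignConnectedDel : Fin n → Set
  SignConnectedDel x = (y z : Fin n) → y ≢ x → z ≢ x → SignConnectedPairDel x y z

  BalancedDel : Fin n → Set
  BalancedDel x = (C : Cycle) → AvoidsVertex x (verts (walk C)) →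
                  chainSign (walk C) ≡ Sign.+

  SignArticulationVertex : Fin n → Set
  SignArticulationVertex x = ¬ SignConnectedDel x

  IsSignBlock : Set
  IsSignBlock = SignConnected × ((x : Fin n) → ¬ SignArticulationVertex x)

  BalancingVertex : Fin n → Set
  BalancingVertex x = BalancedDel x

module Submission where

-- Chain lemmas are stated for the subgraph induced by a vertex predicate P;
-- G - x is the case P = (_≢ x).  The engine is a decomposition lemma: a closed
-- chain is a cycle or splits into two shorter closed chains on its vertices
-- whose signs multiply to its sign.  By induction on length, if all cycles
-- within P are positive, so are all closed chains, and chains with common
-- ends have equal signs (sameSign).  Conversely, in a connected induced
-- subgraph a detour around a negative closed chain yields chains of both
-- signs between any two vertices (bothSigns).
-- (⇒) If x were balancing, two further vertices y ≠ z would be joined in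
--     G - x by chains of both signs, contradicting sameSign.
-- (⇐) If G - x is not sign connected, bothSigns shows all its cycles are
--     positive, since G - x stays connected in the block G; so x balances.

open import Defs
open import Data.Nat using (ℕ; suc; _≤_; _<_; s≤s; z≤n)
open import Data.Nat.Properties using (≤-refl; ≤-trans; <-≤-trans; n≤1+n; m<n⇒m<1+n)
open import Data.Nat.Induction using (<-rec)
open import Data.Fin using (Fin) renaming (zero to fzero; suc to fsuc)
open import Data.Fin.Properties using (_≟_; sequence)
open import Data.Product using (_×_; _,_; Σ; ∃-syntax)
open import Data.Product.Properties using (×-≡,≡←≡)
open import Data.Sum using (_⊎_; inj₁; inj₂; [_,_]′)
import Data.Sum as Sum
open import Data.Sign using (Sign) renaming (_*_ to _⊛_)
open import Data.Sign.Properties using (*-assoc; *-comm; *-identityʳ; s*s≡+; s≢opposite[s])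
open import Data.List using (_∷_)
open import Data.Maybe using (just)
open import Data.List.Membership.Propositional using (_∈_)
open import Data.List.Relation.Binary.Subset.Propositional using (_⊆_)
open import Data.List.Relation.Unary.All using (All; []; _∷_)
import Data.List.Relation.Unary.All as All
open import Data.List.Relation.Unary.All.Properties using (anti-mono; ¬Any⇒All¬)
open import Data.List.Relation.Unary.Any using (here; there; any?)
open import Data.List.Relation.Unary.Unique.Propositional using (Unique)
open import Data.List.Relation.Unary.AllPairs using ([]; _∷_)
open import Data.Empty using (⊥-elim)
open import Effect.Monad using (RawMonad)
open import Function using (id)
open import Relation.Binary.PropositionalEquality
  using (_≡_; _≢_; refl; sym; trans; cong; cong₂; subst; ≢-sym; module ≡-Reasoning)
open import Relation.Nullary using (¬_; yes; no)
open import Relation.Nullary.Negation using (¬¬-Monad)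

⊛-interchange : ∀ a b c → a ⊛ (b ⊛ c) ≡ b ⊛ (a ⊛ c)
⊛-interchange a b c = begin
  a ⊛ (b ⊛ c)  ≡⟨ sym (*-assoc a b c) ⟩
  (a ⊛ b) ⊛ c  ≡⟨ cong (_⊛ c) (*-comm a b) ⟩
  (b ⊛ a) ⊛ c  ≡⟨ *-assoc b a c ⟩
  b ⊛ (a ⊛ c)  ∎
  where open ≡-Reasoning

-- the sign of an edge traversed twice cancels
⊛-cancel-twice : ∀ a e b d → a ⊛ (e ⊛ (b ⊛ (e ⊛ d))) ≡ b ⊛ (a ⊛ d)
⊛-cancel-twice a e b d = begin
  a ⊛ (e ⊛ (b ⊛ (e ⊛ d)))  ≡⟨ cong (a ⊛_) (⊛-interchange e b (e ⊛ d)) ⟩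
  a ⊛ (b ⊛ (e ⊛ (e ⊛ d)))  ≡⟨ cong (λ s → a ⊛ (b ⊛ s)) (sym (*-assoc e e d)) ⟩
  a ⊛ (b ⊛ ((e ⊛ e) ⊛ d))  ≡⟨ cong (λ s → a ⊛ (b ⊛ (s ⊛ d))) (s*s≡+ e) ⟩
  a ⊛ (b ⊛ d)              ≡⟨ ⊛-interchange a b d ⟩
  b ⊛ (a ⊛ d)              ∎
  where open ≡-Reasoning

⊛≡+⇒≡ : ∀ s t → s ⊛ t ≡ Sign.+ → s ≡ t
⊛≡+⇒≡ Sign.+ Sign.+ _ = refl
⊛≡+⇒≡ Sign.- Sign.- _ = refl
⊛≡+⇒≡ Sign.+ Sign.- ()
⊛≡+⇒≡ Sign.- Sign.+ ()

¬¬-∀-Fin : ∀ {k} {Q : Fin k → Set} → (∀ i → ¬ ¬ Q i) → ¬ ¬ (∀ i → Q i)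
¬¬-∀-Fin = sequence (RawMonad.rawApplicative ¬¬-Monad)

¬¬-→ : ∀ {A B : Set} → (A → ¬ ¬ B) → ¬ ¬ (A → B)
¬¬-→ f ¬ab = ¬ab (λ a → ⊥-elim (f a (λ b → ¬ab (λ _ → b))))

twoOthers : ∀ {n} → 3 ≤ n → (x : Fin n) → ∃[ y ] ∃[ z ] (y ≢ x × z ≢ x × y ≢ z)
twoOthers (s≤s (s≤s (s≤s _))) fzero           =
  fsuc fzero , fsuc (fsuc fzero) , (λ ()) , (λ ()) , (λ ())
twoOthers (s≤s (s≤s (s≤s _))) (fsuc fzero)    =
  fzero , fsuc (fsuc fzero) , (λ ()) , (λ ()) , (λ ())
twoOthers (s≤s (s≤s (s≤s _))) (fsuc (fsuc _)) =
  fzero , fsuc fzero , (λ ()) , (λ ()) , (λ ())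

module _ {n m : ℕ} (G : SignedGraph n m) where

  _++_ : ∀ {u v w} → Chain G u v → Chain G v w → Chain G u w
  [] _       ++ d = d
  step e j c ++ d = step e j (c ++ d)

  len : ∀ {u v} → Chain G u v → ℕ
  len ([] _)       = 0
  len (step _ _ c) = suc (len c)

  flipJoins : ∀ {e u w} → Joins G e u w → Joins G e w u
  flipJoins (inj₁ p) = inj₂ p
  flipJoins (inj₂ p) = inj₁ p

  rev : ∀ {u v} → Chain G u v → Chain G v u
  rev ([] v)           = [] v
  rev (step {u} e j c) = rev c ++ step e (flipJoins j) ([] u)

  sign-++ : ∀ {u v w} (c : Chain G u v) (d : Chain G v w) →
            chainSign G (c ++ d) ≡ chainSign G c ⊛ chainSign G d
  sign-++ ([] _)       d = refl
  sign-++ (step e j c) d =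
    trans (cong (sgn G e ⊛_) (sign-++ c d)) (sym (*-assoc (sgn G e) (chainSign G c) (chainSign G d)))

  sign-rev : ∀ {u v} (c : Chain G u v) → chainSign G (rev c) ≡ chainSign G c
  sign-rev ([] _)           = refl
  sign-rev (step {u} e j c) = begin
    chainSign G (rev c ++ step e (flipJoins j) ([] u))
      ≡⟨ sign-++ (rev c) _ ⟩
    chainSign G (rev c) ⊛ (sgn G e ⊛ Sign.+)
      ≡⟨ cong₂ _⊛_ (sign-rev c) (*-identityʳ (sgn G e)) ⟩
    chainSign G c ⊛ sgn G e
      ≡⟨ *-comm (chainSign G c) (sgn G e) ⟩
    sgn G e ⊛ chainSign G c
      ∎
    where open ≡-Reasoning

  len-≤-++ʳ : ∀ {u v w} (c : Chain G u v) (d : Chain G v w) → len d ≤ len (c ++ d)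
  len-≤-++ʳ ([] _)       d = ≤-refl
  len-≤-++ʳ (step _ _ c) d = ≤-trans (len-≤-++ʳ c d) (n≤1+n _)

  len-<-++ˡ : ∀ {u v w} (c : Chain G u v) (d : Chain G v w) → 0 < len d → len c < len (c ++ d)
  len-<-++ˡ ([] _)       d 0<d = 0<d
  len-<-++ˡ (step _ _ c) d 0<d = s≤s (len-<-++ˡ c d 0<d)

  len-<-++ʳ : ∀ {u v w} (c : Chain G u v) (d : Chain G v w) → 0 < len c → len d < len (c ++ d)
  len-<-++ʳ (step _ _ c) d _ = s≤s (len-≤-++ʳ c d)

  len-++-monoʳ : ∀ {u v w} (c : Chain G u v) {d d′ : Chain G v w} → len d < len d′ →
                 len (c ++ d) < len (c ++ d′)
  len-++-monoʳ ([] _)       d<d′ = d<d′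
  len-++-monoʳ (step _ _ c) d<d′ = s≤s (len-++-monoʳ c d<d′)

  head∈ : ∀ {u v} (c : Chain G u v) → u ∈ verts G c
  head∈ ([] _)       = here refl
  head∈ (step _ _ _) = here refl

  last∈ : ∀ {u v} (c : Chain G u v) → v ∈ verts G c
  last∈ ([] _)       = here refl
  last∈ (step _ _ c) = there (last∈ c)

  ∈-++ˡ : ∀ {u v w y} (c : Chain G u v) (d : Chain G v w) → y ∈ verts G c → y ∈ verts G (c ++ d)
  ∈-++ˡ ([] _)       d (here refl) = head∈ d
  ∈-++ˡ ([] _)       d (there ())
  ∈-++ˡ (step _ _ c) d (here y≡u)  = here y≡u
  ∈-++ˡ (step _ _ c) d (there y∈c) = there (∈-++ˡ c d y∈c)

  ∈-++ʳ : ∀ {u v w y} (c : Chain G u v) (d : Chain G v w) → y ∈ verts G d → y ∈ verts G (c ++ d)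
  ∈-++ʳ ([] _)       d y∈d = y∈d
  ∈-++ʳ (step _ _ c) d y∈d = there (∈-++ʳ c d y∈d)

  ∈-++⁻ : ∀ {u v w y} (c : Chain G u v) (d : Chain G v w) →
          y ∈ verts G (c ++ d) → y ∈ verts G c ⊎ y ∈ verts G d
  ∈-++⁻ ([] _)       d y∈d          = inj₂ y∈d
  ∈-++⁻ (step _ _ c) d (here y≡u)   = inj₁ (here y≡u)
  ∈-++⁻ (step _ _ c) d (there y∈cd) = Sum.map there id (∈-++⁻ c d y∈cd)

  ⊆-++ : ∀ {u v w} (c : Chain G u v) {d d′ : Chain G v w} →
         verts G d ⊆ verts G d′ → verts G (c ++ d) ⊆ verts G (c ++ d′)
  ⊆-++ c {d} {d′} d⊆d′ y∈cd = [ ∈-++ˡ c d′ , (λ y∈d → ∈-++ʳ c d′ (d⊆d′ y∈d)) ]′ (∈-++⁻ c d y∈cd)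

  ∈-rev : ∀ {u v y} (c : Chain G u v) → y ∈ verts G (rev c) → y ∈ verts G c
  ∈-rev ([] _)           y∈ = y∈
  ∈-rev (step {u} e j c) y∈ with ∈-++⁻ (rev c) (step e (flipJoins j) ([] u)) y∈
  ... | inj₁ y∈rc                = there (∈-rev c y∈rc)
  ... | inj₂ (here refl)         = there (head∈ c)
  ... | inj₂ (there (here refl)) = here refl
  ... | inj₂ (there (there ()))

  Within : (Fin n → Set) → ∀ {u v} → Chain G u v → Set
  Within P c = All P (verts G c)

  within-++ : ∀ {P u v w} (c : Chain G u v) (d : Chain G v w) →
              Within P c → Within P d → Within P (c ++ d)
  within-++ c d inC inD =
    All.tabulate (λ y∈ → [ All.lookup inC , All.lookup inD ]′ (∈-++⁻ c d y∈))

  within-rev : ∀ {P u v} (c : Chain G u v) → Within P c → Within P (rev c)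
  within-rev c = anti-mono (∈-rev c)

  _++ᴾ_ : ∀ {P u v w} → Σ (Chain G u v) (Within P) → Σ (Chain G v w) (Within P) →
          Σ (Chain G u w) (Within P)
  (c , inC) ++ᴾ (d , inD) = c ++ d , within-++ c d inC inD

  sameEdge : ∀ {e x y p q} → Joins G e x y → Joins G e p q → (p ≡ x × q ≡ y) ⊎ (p ≡ y × q ≡ x)
  sameEdge (inj₁ h₁) (inj₁ h₂) = inj₁ (×-≡,≡←≡ (trans (sym h₂) h₁))
  sameEdge (inj₁ h₁) (inj₂ h₂) with ×-≡,≡←≡ (trans (sym h₂) h₁)
  ... | q≡x , p≡y = inj₂ (p≡y , q≡x)
  sameEdge (inj₂ h₁) (inj₁ h₂) = inj₂ (×-≡,≡←≡ (trans (sym h₂) h₁))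
  sameEdge (inj₂ h₁) (inj₂ h₂) with ×-≡,≡←≡ (trans (sym h₂) h₁)
  ... | q≡y , p≡x = inj₁ (p≡x , q≡y)

  splitAt : ∀ {u v t} (c : Chain G u v) → t ∈ initVerts G c →
            Σ (Chain G u t) λ a → Σ (Chain G t v) λ b → (c ≡ a ++ b) × (0 < len b)
  splitAt (step {u} e j c) (here refl) = [] u , step e j c , refl , s≤s z≤n
  splitAt (step e j c) (there t∈c) with splitAt c t∈c
  ... | a , b , refl , 0<b = step e j a , b , refl , 0<b

  data RepeatedVertex {u v} (c : Chain G u v) : Set where
    repeatedVertex : ∀ {t} (a : Chain G u t) (b : Chain G t t) (d : Chain G t v) →
      c ≡ a ++ (b ++ d) → 0 < len b → 0 < len d → RepeatedVertex c

  vertexRepetition : ∀ {u v} (c : Chain G u v) → Unique (initVerts G c) ⊎ RepeatedVertex c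
  vertexRepetition ([] _) = inj₁ []
  vertexRepetition (step {u} e j c) with any? (u ≟_) (initVerts G c)
  ... | yes u∈c with splitAt c u∈c
  ...   | a , d , refl , 0<d = inj₂ (repeatedVertex ([] u) (step e j a) d refl (s≤s z≤n) 0<d)
  vertexRepetition (step {u} e j c) | no u∉c with vertexRepetition c
  ... | inj₁ unique = inj₁ (¬Any⇒All¬ _ u∉c ∷ unique)
  ... | inj₂ (repeatedVertex a b d refl 0<b 0<d) =
          inj₂ (repeatedVertex (step e j a) b d refl 0<b 0<d)

  splitAtEdge : ∀ {u v e} (c : Chain G u v) → e ∈ edgesOf G c →
                ∃[ p ] ∃[ q ] Σ (Chain G u p) λ a → Σ (Joins G e p q) λ j →
                  Σ (Chain G q v) λ d → c ≡ a ++ step e j d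
  splitAtEdge (step {u} e j c) (here refl) = _ , _ , [] u , j , c , refl
  splitAtEdge (step e j c) (there e∈c) with splitAtEdge c e∈c
  ... | p , q , a , j′ , d , refl = p , q , step e j a , j′ , d , refl

  data RepeatedEdge {u v} (c : Chain G u v) : Set where
    repeatedEdge : ∀ {e x y p q} (a : Chain G u x) (j₁ : Joins G e x y) (b : Chain G y p)
      (j₂ : Joins G e p q) (d : Chain G q v) → c ≡ a ++ step e j₁ (b ++ step e j₂ d) →
      RepeatedEdge c

  edgeRepetition : ∀ {u v} (c : Chain G u v) → Unique (edgesOf G c) ⊎ RepeatedEdge c
  edgeRepetition ([] _) = inj₁ []
  edgeRepetition (step {u} e j c) with any? (e ≟_) (edgesOf G c)
  ... | yes e∈c with splitAtEdge c e∈c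
  ...   | _ , _ , b , j₂ , d , refl = inj₂ (repeatedEdge ([] u) j b j₂ d refl)
  edgeRepetition (step e j c) | no e∉c with edgeRepetition c
  ... | inj₁ unique = inj₁ (¬Any⇒All¬ _ e∉c ∷ unique)
  ... | inj₂ (repeatedEdge a j₁ b j₂ d refl) = inj₂ (repeatedEdge (step e j a) j₁ b j₂ d refl)

  record Decomposition {v} (w : Chain G v v) : Set where
    field
      base₁ base₂ : Fin n
      piece₁      : Chain G base₁ base₁
      piece₂      : Chain G base₂ base₂
      shorter₁    : len piece₁ < len w
      shorter₂    : len piece₂ < len w
      sign-split  : chainSign G w ≡ chainSign G piece₁ ⊛ chainSign G piece₂
      verts₁      : verts G piece₁ ⊆ verts G w
      verts₂      : verts G piece₂ ⊆ verts G w

  excise : ∀ {u t} (a : Chain G u t) (b : Chain G t t) (d : Chain G t u) →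
           0 < len b → 0 < len d → Decomposition (a ++ (b ++ d))
  excise a b d 0<b 0<d = record
    { piece₁     = b
    ; piece₂     = a ++ d
    ; shorter₁   = <-≤-trans (len-<-++ˡ b d 0<d) (len-≤-++ʳ a (b ++ d))
    ; shorter₂   = len-++-monoʳ a (len-<-++ʳ b d 0<b)
    ; sign-split = signs
    ; verts₁     = λ y∈b → ∈-++ʳ a (b ++ d) (∈-++ˡ b d y∈b)
    ; verts₂     = ⊆-++ a (∈-++ʳ b d)
    }
    where
      open ≡-Reasoning
      signs : chainSign G (a ++ (b ++ d)) ≡ chainSign G b ⊛ chainSign G (a ++ d)
      signs = begin
        chainSign G (a ++ (b ++ d))
          ≡⟨ sign-++ a (b ++ d) ⟩
        chainSign G a ⊛ chainSign G (b ++ d)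
          ≡⟨ cong (chainSign G a ⊛_) (sign-++ b d) ⟩
        chainSign G a ⊛ (chainSign G b ⊛ chainSign G d)
          ≡⟨ ⊛-interchange (chainSign G a) (chainSign G b) (chainSign G d) ⟩
        chainSign G b ⊛ (chainSign G a ⊛ chainSign G d)
          ≡⟨ cong (chainSign G b ⊛_) (sym (sign-++ a d)) ⟩
        chainSign G b ⊛ chainSign G (a ++ d)
          ∎

  backtrack : ∀ {v e x y} (a : Chain G v x) (j₁ : Joins G e x y) (b : Chain G y y)
              (j₂ : Joins G e y x) (d : Chain G x v) →
              Decomposition (a ++ step e j₁ (b ++ step e j₂ d))
  backtrack {e = e} a j₁ b j₂ d = record
    { piece₁     = b
    ; piece₂     = a ++ d
    ; shorter₁   = <-≤-trans (m<n⇒m<1+n (len-<-++ˡ b (step e j₂ d) (s≤s z≤n))) (len-≤-++ʳ a _)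
    ; shorter₂   = len-++-monoʳ a (s≤s (≤-trans (n≤1+n (len d)) (len-≤-++ʳ b (step e j₂ d))))
    ; sign-split = signs
    ; verts₁     = λ y∈b → ∈-++ʳ a _ (there (∈-++ˡ b (step e j₂ d) y∈b))
    ; verts₂     = ⊆-++ a (λ y∈d → there (∈-++ʳ b (step e j₂ d) (there y∈d)))
    }
    where
      open ≡-Reasoning
      signs : chainSign G (a ++ step e j₁ (b ++ step e j₂ d)) ≡ chainSign G b ⊛ chainSign G (a ++ d)
      signs = begin
        chainSign G (a ++ step e j₁ (b ++ step e j₂ d))
          ≡⟨ sign-++ a _ ⟩
        chainSign G a ⊛ (sgn G e ⊛ chainSign G (b ++ step e j₂ d))
          ≡⟨ cong (λ s → chainSign G a ⊛ (sgn G e ⊛ s)) (sign-++ b (step e j₂ d)) ⟩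
        chainSign G a ⊛ (sgn G e ⊛ (chainSign G b ⊛ (sgn G e ⊛ chainSign G d)))
          ≡⟨ ⊛-cancel-twice (chainSign G a) (sgn G e) (chainSign G b) (chainSign G d) ⟩
        chainSign G b ⊛ (chainSign G a ⊛ chainSign G d)
          ≡⟨ cong (chainSign G b ⊛_) (sym (sign-++ a d)) ⟩
        chainSign G b ⊛ chainSign G (a ++ d)
          ∎

  cycleOrDecomposition : ∀ {v} (w : Chain G v v) →
    (Unique (edgesOf G w) × Unique (initVerts G w)) ⊎ Decomposition w
  cycleOrDecomposition w with vertexRepetition w
  ... | inj₂ (repeatedVertex a b d refl 0<b 0<d) = inj₂ (excise a b d 0<b 0<d)
  ... | inj₁ distinctVerts with edgeRepetition w
  ...   | inj₁ distinctEdges = inj₁ (distinctEdges , distinctVerts)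
  ...   | inj₂ (repeatedEdge a j₁ b j₂ d refl) with sameEdge j₁ j₂
  ...     | inj₁ (refl , refl) = inj₂ (excise a (step _ j₁ b) (step _ j₂ d) (s≤s z≤n) (s≤s z≤n))
  ...     | inj₂ (refl , refl) = inj₂ (backtrack a j₁ b j₂ d)

  BalancedOn : (Fin n → Set) → Set
  BalancedOn P = (C : Cycle G) → Within P (walk C) → chainSign G (walk C) ≡ Sign.+

  closedChainPositive : ∀ {P} → BalancedOn P → ∀ {v} (w : Chain G v v) → Within P w →
                        chainSign G w ≡ Sign.+
  closedChainPositive {P} balanced w = <-rec Goal positive (len w) w refl
    where
      Goal : ℕ → Set
      Goal k = ∀ {v} (w : Chain G v v) → len w ≡ k → Within P w → chainSign G w ≡ Sign.+

      positive : ∀ k → (∀ {j} → j < k → Goal j) → Goal k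
      positive _ _               ([] _)         _    _   = refl
      positive _ shorterPositive w@(step _ _ _) refl inW with cycleOrDecomposition w
      ... | inj₁ (distinctEdges , distinctVerts) = balanced cycle inW
        where
          cycle : Cycle G
          cycle = record { base = _ ; walk = w ; nonEmpty = λ ()
                         ; edgesDistinct = distinctEdges ; vertsDistinct = distinctVerts }
      ... | inj₂ D = trans sign-split (cong₂ _⊛_ (piecePositive piece₁ shorter₁ verts₁)
                                                 (piecePositive piece₂ shorter₂ verts₂))
        where
          open Decomposition D
          piecePositive : ∀ {b} (p : Chain G b b) → len p < len w → verts G p ⊆ verts G w →
                          chainSign G p ≡ Sign.+
          piecePositive p shorter p⊆w = shorterPositive shorter p refl (anti-mono p⊆w inW)

  sameSign : ∀ {P y z} → BalancedOn P → (p q : Chain G y z) → Within P p → Within P q →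
             chainSign G p ≡ chainSign G q
  sameSign balanced p q inP inQ = ⊛≡+⇒≡ (chainSign G p) (chainSign G q) (begin
    chainSign G p ⊛ chainSign G q        ≡⟨ cong (chainSign G p ⊛_) (sym (sign-rev q)) ⟩
    chainSign G p ⊛ chainSign G (rev q)  ≡⟨ sym (sign-++ p (rev q)) ⟩
    chainSign G (p ++ rev q)             ≡⟨ closedChainPositive balanced (p ++ rev q)
                                              (within-++ p (rev q) inP (within-rev q inQ)) ⟩
    Sign.+                               ∎)
    where open ≡-Reasoning

  ConnectedOn : (Fin n → Set) → Set
  ConnectedOn P = ∀ y z → P y → P z → Σ (Chain G y z) (Within P)

  SignedChainsOn : (Fin n → Set) → Fin n → Fin n → Sign → Set
  SignedChainsOn P y z s = Σ (Chain G y z) λ c → Within P c × chainSign G c ≡ s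

  -- in a connected induced subgraph with a negative closed chain w, any two
  -- vertices are joined by a direct chain and by one detouring around w, and
  -- these have opposite signs
  bothSigns : ∀ {P b y z} → ConnectedOn P → (w : Chain G b b) → Within P w →
              chainSign G w ≡ Sign.- → P y → P z →
              SignedChainsOn P y z Sign.+ × SignedChainsOn P y z Sign.-
  bothSigns {b = b} {y} {z} connected w inW negative Py Pz
    with connected y b Py (All.lookup inW (head∈ w)) | connected b z (All.lookup inW (head∈ w)) Pz
  ... | p , inP | q , inQ = bySign (chainSign G direct) refl
    where
      open ≡-Reasoning
      direct = p ++ q
      detour = p ++ (w ++ q)

      inDirect : Within _ direct
      inDirect = within-++ p q inP inQ

      inDetour : Within _ detour
      inDetour = within-++ p (w ++ q) inP (within-++ w q inW inQ)

      detourSign : chainSign G detour ≡ Sign.- ⊛ chainSign G direct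
      detourSign = begin
        chainSign G (p ++ (w ++ q))
          ≡⟨ sign-++ p (w ++ q) ⟩
        chainSign G p ⊛ chainSign G (w ++ q)
          ≡⟨ cong (chainSign G p ⊛_) (sign-++ w q) ⟩
        chainSign G p ⊛ (chainSign G w ⊛ chainSign G q)
          ≡⟨ ⊛-interchange (chainSign G p) (chainSign G w) (chainSign G q) ⟩
        chainSign G w ⊛ (chainSign G p ⊛ chainSign G q)
          ≡⟨ cong₂ _⊛_ negative (sym (sign-++ p q)) ⟩
        Sign.- ⊛ chainSign G direct
          ∎

      bySign : ∀ s → chainSign G direct ≡ s →
               SignedChainsOn _ y z Sign.+ × SignedChainsOn _ y z Sign.-
      bySign Sign.+ eq = (direct , inDirect , eq) , (detour , inDetour , detourSign′)
        where detourSign′ = trans detourSign (cong (Sign.- ⊛_) eq)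
      bySign Sign.- eq = (detour , inDetour , detourSign′) , (direct , inDirect , eq)
        where detourSign′ = trans detourSign (cong (Sign.- ⊛_) eq)

  edgeLink : ∀ {P e y t s z} → Joins G e y t → Joins G e s z → P y → P z →
             Σ (Chain G y z) (Within P)
  edgeLink {t = t} j₁ j₂ Py Pz with sameEdge j₁ j₂
  ... | inj₁ (_ , refl) = step _ j₁ ([] t) , Py ∷ Pz ∷ []
  ... | inj₂ (_ , refl) = [] _ , Py ∷ []

  dropLast : ∀ {u w f} (c : Chain G u w) → lastEdge G c ≡ just f →
             Σ (Fin n) λ s → Σ (Chain G u s) λ a → Joins G f s w × verts G a ≡ initVerts G c
  dropLast (step {u} e j ([] _)) refl = u , [] u , j , refl
  dropLast (step {u} e j c@(step _ _ _)) last≡f with dropLast c last≡f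
  ... | s , a , j′ , eq = s , step e j a , j′ , cong (u ∷_) eq

  lastEdgeOf : ∀ {u v w e} (j : Joins G e u w) (c : Chain G w v) →
               ∃[ f ] ∃[ s ] (Joins G f s v × lastEdge G (step e j c) ≡ just f)
  lastEdgeOf {u} {e = e} j ([] _) = e , u , j , refl
  lastEdgeOf j (step _ j′ c)         = lastEdgeOf j′ c

  reroute : ∀ {P e₁ f y t s z u w} → Joins G e₁ y t → Joins G f s z → P y → P z →
            (c : Chain G u w) → firstEdge G c ≡ just e₁ → lastEdge G c ≡ just f →
            All P (interior G c) → Σ (Chain G y z) (Within P)
  reroute j₁ j_f Py Pz (step _ j ([] _)) refl refl _ = edgeLink j₁ j_f Py Pz
  reroute {P} j₁ j_f Py Pz (step _ j c@(step _ _ _)) refl last≡f inInterior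
    with dropLast c last≡f
  ... | s , a , j_s , verts≡ =
    edgeLink j₁ j Py (All.lookup inA (head∈ a))
      ++ᴾ ((a , inA) ++ᴾ edgeLink j_s j_f (All.lookup inA (last∈ a)) Pz)
    where
      inA : Within P a
      inA = subst (All P) (sym verts≡) inInterior

  -- in a block, two vertices joined by a chain remain joined after deleting
  -- any third vertex x (double negated: a block has no articulation vertex)
  blockMinusVertex : ∀ {x y z} → IsBlock G → y ≢ x → z ≢ x → Chain G y z →
                     ¬ ¬ Σ (Chain G y z) (Within (_≢ x))
  blockMinusVertex _ y≢x z≢x ([] y) noChain = noChain ([] y , y≢x ∷ [])
  blockMinusVertex {x} block y≢x z≢x (step e₁ j₁ c) noChain with lastEdgeOf j₁ c
  ... | f , _ , j_f , _ = block x (e₁ , f , throughX)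
    where
      throughX : (u w : Fin n) (c′ : Chain G u w) → firstEdge G c′ ≡ just e₁ →
                 lastEdge G c′ ≡ just f → x ∈ interior G c′
      throughX _ _ c′ first≡ last≡ with any? (x ≟_) (interior G c′)
      ... | yes x∈ = x∈
      ... | no x∉ = ⊥-elim (noChain (reroute j₁ j_f y≢x z≢x c′ first≡ last≡
                                       (All.map ≢-sym (¬Any⇒All¬ _ x∉))))

  connectedMinusVertex : SignConnected G → IsBlock G → (x : Fin n) → ¬ ¬ ConnectedOn (_≢ x)
  connectedMinusVertex signConnected block x =
    ¬¬-∀-Fin λ y → ¬¬-∀-Fin λ z → ¬¬-→ λ y≢x → ¬¬-→ λ z≢x →
      blockMinusVertex block y≢x z≢x (someChain (signConnected y z))
    where
      someChain : ∀ {y z} → SignConnectedPair G y z → Chain G y z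
      someChain (inj₁ refl)          = [] _
      someChain (inj₂ ((c , _) , _)) = c

  -- (⇒) a balancing vertex x is a sign articulation vertex: two further
  -- vertices y ≠ z cannot be joined in G - x by chains of both signs
  balancing⇒signArticulation : 3 ≤ n → (x : Fin n) → BalancingVertex G x →
                               SignArticulationVertex G x
  balancing⇒signArticulation three x balanced signConnectedDel
    with twoOthers three x
  ... | y , z , y≢x , z≢x , y≢z with signConnectedDel y z y≢x z≢x
  ...   | inj₁ y≡z = y≢z y≡z
  ...   | inj₂ ((p , inP , p+) , (q , inQ , q-)) =
          s≢opposite[s] Sign.+ (trans (sym p+) (trans (sameSign balanced p q inP inQ) q-))

  -- (⇐) a sign articulation vertex x is balancing: a negative cycle of G - x
  -- would make the connected graph G - x sign connected
  signArticulation⇒balancing : SignConnected G → IsBlock G → (x : Fin n) →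
                               SignArticulationVertex G x → BalancingVertex G x
  signArticulation⇒balancing signConnected block x notSignConnected C inC
    with chainSign G (walk C) in sign≡
  ... | Sign.+ = refl
  ... | Sign.- = ⊥-elim (connectedMinusVertex signConnected block x λ connected →
                   notSignConnected λ y z y≢x z≢x →
                     inj₂ (bothSigns connected (walk C) inC sign≡ y≢x z≢x))

theorem3p14 : (n m : ℕ) (G : SignedGraph n m) →
    3 ≤ n → SignConnected G → IsBlock G →
    (IsSignBlock G → ¬ (∃[ x ] BalancingVertex G x))
    × (¬ (∃[ x ] BalancingVertex G x) → IsSignBlock G)
theorem3p14 n m G three signConnected block = signBlock⇒noBalancing , noBalancing⇒signBlock
  where
    signBlock⇒noBalancing : IsSignBlock G → ¬ (∃[ x ] BalancingVertex G x)
    signBlock⇒noBalancing (_ , noSignArticulation) (x , balancing) =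
      noSignArticulation x (balancing⇒signArticulation G three x balancing)

    noBalancing⇒signBlock : ¬ (∃[ x ] BalancingVertex G x) → IsSignBlock G
    noBalancing⇒signBlock noBalancing = signConnected , λ x signArticulation →
      noBalancing (x , signArticulation⇒balancing G signConnected block x signArticulation)
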